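{- Let $T$ be a binary tree with multiplicities that is of the form $\mathcal B(w)$ for some packed word $w$. Then the number $f(T)$ of packed words $u$ with $\mathcal B(u)=T$ is $$f(T)=|T|!\left(\prod_{t\in T}|t|\,(m(t)-1)!\right)^{ -1},$$ where $t$ ranges over all subtrees of $T$ (the subtree rooted at each node of $T$), $m(t)$ is the multiplicity of the root of $t$, and $|t|$ is the size of $t$ (sum of the multiplicities of its nodes).
   Context: A packed word is a word $w$ over the positive integers whose set of letters is $\{1,\dots,r\}$ for some $r$. A binary search tree with multiplicities (BSTM) is a planar binary tree whose nodes are labelled by pairs $(l,k)$ of a letter $l$ and a positive integer multiplicity $k$, such that forgetting multiplicities gives a binary search tree (smaller letters in left subtrees, larger in right subtrees) and each letter appears at most once. Insertion of a letter $l$ into a BSTM $t$: if $t$ is empty, return the single node $(l,1)$; if the root letter equals $l$, increment the root multiplicity; if $l$ is smaller than the root letter, insert recursively into the left subtree; otherwise into the right subtree. $\mathcal P(w)$ is obtained by inserting the letters of $w$ from right to left starting with the empty tree. A binary tree with multiplicities (BTM) is a planar binary tree whose nodes carry integer multiplicities; its size is the sum of the multiplicities. $\mathcal B(w)$ is the BTM obtained from $\mathcal P(w)$ by forgetting the letters and keeping only the multiplicities. -}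

module Defs where

open import Data.Nat using (ℕ; zero; suc; _+_; _*_; _∸_; _<ᵇ_; _≡ᵇ_; _≤_)
open import Data.Bool using (Bool; true; false; if_then_else_)
open import Data.List using (List; []; _∷_; foldr)
open import Data.List.Membership.Propositional using (_∈_)
open import Data.Product using (_×_)
open import Relation.Binary.PropositionalEquality using (_≡_)

Packed : List ℕ → Set
Packed w = Data.Product.Σ ℕ λ r →
  ((l : ℕ) → l ∈ w → (1 ≤ l × l ≤ r)) × ((l : ℕ) → 1 ≤ l → l ≤ r → l ∈ w)

data BSTM : Set where
  leaf : BSTM
  node : BSTM → ℕ → ℕ → BSTM → BSTM   -- left, letter, multiplicity, right

data BTM : Set where
  leaf : BTM
  node : BTM → ℕ → BTM → BTM          -- left, multiplicity, right

insert : ℕ → BSTM → BSTM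
insert l leaf = node leaf l 1 leaf
insert l (node lt a k rt) =
  if l ≡ᵇ a then node lt a (suc k) rt
  else if l <ᵇ a then node (insert l lt) a k rt
  else node lt a k (insert l rt)

P : List ℕ → BSTM
P w = foldr insert leaf w

forget : BSTM → BTM
forget leaf = leaf
forget (node lt _ k rt) = node (forget lt) k (forget rt)

B : List ℕ → BTM
B w = forget (P w)

size : BTM → ℕ
size leaf = 0
size (node l k r) = size l + k + size r

factorial : ℕ → ℕ
factorial zero = 1
factorial (suc n) = suc n * factorial n

hookProd : BTM → ℕ
hookProd leaf = 1
hookProd (node l k r) = size (node l k r) * factorial (k ∸ 1) * hookProd l * hookProd r

module Submission where

-- Write labelFrom o T for the canonical labelling of the shape T by the consecutive
-- letters o, o+1, … in symmetric order.  A packed word u satisfies B(u) = T exactly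
-- when P(u) = labelFrom 1 T: P(u) is a search tree whose letter set is an interval,
-- and such a tree is determined by its shape (search-canonical).  So it suffices to
-- enumerate the words u with P(u) = labelFrom o T.  Inserting from the right, the last
-- letter a of u becomes the root and P(u) = node (P x) a (k+1) (P y), where x and y are
-- the subwords of letters below and above a and k counts the other copies of a (P-snoc).
-- Hence these words are exactly v a with v an interleaving of a word for the left
-- subtree, a word for the right subtree and k copies of a.  The pieces are recovered
-- from v by projecting onto the three alphabets, so the resulting enumeration
-- (preimage) has no repetitions and has f(L) f(R) (q+k choose q) (p+q+k choose p)
-- entries, where p, q are the sizes of the subtrees.  Induction with the identity
-- (m+n choose m) m! n! = (m+n)! gives f(T) · ∏ |t| (m(t)−1)! = |T|!.

open import Defs
open import Data.Nat using (ℕ; zero; suc; _+_; _*_; _≤_; _<_; _<?_; _≟_; z≤n; s≤s; s≤s⁻¹)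
open import Data.Nat.Properties
  using (+-identityʳ; +-suc; *-identityˡ; *-identityʳ; *-distribʳ-+; suc-injective; <-cmp; n≮n;
         <-irrefl; <-asym; <-trans; ≤-refl; ≤-trans; ≤-antisym; <⇒≤; <⇒≢; >⇒≢; <⇒≯; <⇒≱; ≮⇒≥;
         m≤m+n; m≤n⇒m<n∨m≡n)
open import Data.Nat.Tactic.RingSolver using (solve-∀)
open import Data.List
  using (List; []; _∷_; [_]; _++_; _∷ʳ_; map; concatMap; filter; length; replicate; initLast; _∷ʳ′_)
open import Data.List.Properties
  using (length-++; length-map; length-replicate; filter-accept; filter-reject; ∷-injective; ∷ʳ-injectiveˡ)
open import Data.List.Membership.Propositional using (_∈_; find; lose)
open import Data.List.Membership.Propositional.Properties
  using (∈-map⁺; ∈-map⁻; ∈-++⁺ˡ; ∈-++⁺ʳ; ∈-++⁻; ∈-concatMap⁺; ∈-concatMap⁻)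
open import Data.List.Relation.Unary.Any using (here; there)
open import Data.List.Relation.Unary.All using (All; []; _∷_)
import Data.List.Relation.Unary.All as All
open import Data.List.Relation.Unary.All.Properties using (all-filter; replicate⁺)
import Data.List.Relation.Unary.All.Properties as All
open import Data.List.Relation.Unary.AllPairs using ([]; _∷_)
open import Data.List.Relation.Unary.Unique.Propositional using (Unique)
import Data.List.Relation.Unary.Unique.Propositional.Properties as Unique
open import Data.List.Relation.Ternary.Interleaving.Propositional using (Interleaving; []; consˡ; consʳ)
open import Data.List.Relation.Ternary.Interleaving.Properties using (interleave-length)
open import Data.List.Relation.Ternary.Interleaving.Propositional.Properties using (filter⁺)
open import Data.Product using (Σ; _×_; _,_; proj₁; proj₂)
open import Data.Sum using (_⊎_; inj₁; inj₂)
import Data.Sum as Sum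
open import Data.Empty using (⊥-elim)
open import Function using (_∘_)
open import Function.Bundles using (_⇔_; mk⇔)
import Function.Properties.Equivalence as ⇔
open import Relation.Nullary using (¬_; ¬?)
open import Relation.Nullary.Decidable using (dec-true; dec-false)
open import Relation.Unary using (Decidable; ∁)
open import Relation.Binary.Definitions using (tri<; tri≈; tri>)
open import Relation.Binary.PropositionalEquality
  using (_≡_; refl; sym; trans; cong; cong₂; subst; module ≡-Reasoning)

Unique-concatMap : ∀ {A B : Set} (f : A → List B) (g : B → A) {xs : List A} →
  Unique xs → (∀ {x} → x ∈ xs → Unique (f x)) →
  (∀ {x s} → x ∈ xs → s ∈ f x → g s ≡ x) → Unique (concatMap f xs)
Unique-concatMap f g [] _ _ = []
Unique-concatMap f g {x ∷ xs} (x∉xs ∷ uxs) ufx ginv =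
  Unique.++⁺ (ufx (here refl))
    (Unique-concatMap f g uxs (ufx ∘ there) (ginv ∘ there))
    blocksDisjoint
  where
  blocksDisjoint : ∀ {s} → ¬ (s ∈ f x × s ∈ concatMap f xs)
  blocksDisjoint {s} (s∈fx , s∈rest) =
    let (y , y∈xs , s∈fy) = find (∈-concatMap⁻ f s∈rest) in
    All.lookup x∉xs y∈xs (trans (sym (ginv (here refl) s∈fx)) (ginv (there y∈xs) s∈fy))

length-concatMap : ∀ {A B : Set} (f : A → List B) {c : ℕ} (xs : List A) →
  (∀ {x} → x ∈ xs → length (f x) ≡ c) → length (concatMap f xs) ≡ length xs * c
length-concatMap f [] _ = refl
length-concatMap f (x ∷ xs) len =
  trans (length-++ (f x)) (cong₂ _+_ (len (here refl)) (length-concatMap f xs (len ∘ there)))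

module _ {A : Set} where

  shuffle : List A → List A → List (List A)
  shuffle [] [] = [ [] ]
  shuffle [] (b ∷ t) = map (b ∷_) (shuffle [] t)
  shuffle (a ∷ x) [] = map (a ∷_) (shuffle x [])
  shuffle (a ∷ x) (b ∷ t) = map (a ∷_) (shuffle x (b ∷ t)) ++ map (b ∷_) (shuffle (a ∷ x) t)

  ∈-shuffle⁺ : ∀ {x t s} → Interleaving x t s → s ∈ shuffle x t
  ∈-shuffle⁺ [] = here refl
  ∈-shuffle⁺ {t = []} (consˡ sp) = ∈-map⁺ _ (∈-shuffle⁺ sp)
  ∈-shuffle⁺ {t = _ ∷ _} (consˡ sp) = ∈-++⁺ˡ (∈-map⁺ _ (∈-shuffle⁺ sp))
  ∈-shuffle⁺ {x = []} (consʳ sp) = ∈-map⁺ _ (∈-shuffle⁺ sp)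
  ∈-shuffle⁺ {x = _ ∷ _} (consʳ sp) = ∈-++⁺ʳ _ (∈-map⁺ _ (∈-shuffle⁺ sp))

  ∈-shuffle⁻ : ∀ x t {s} → s ∈ shuffle x t → Interleaving x t s
  ∈-shuffle⁻ [] [] (here refl) = []
  ∈-shuffle⁻ [] (b ∷ t) s∈ with ∈-map⁻ (b ∷_) s∈
  ... | _ , s′∈ , refl = consʳ (∈-shuffle⁻ [] t s′∈)
  ∈-shuffle⁻ (a ∷ x) [] s∈ with ∈-map⁻ (a ∷_) s∈
  ... | _ , s′∈ , refl = consˡ (∈-shuffle⁻ x [] s′∈)
  ∈-shuffle⁻ (a ∷ x) (b ∷ t) s∈ with ∈-++⁻ (map (a ∷_) (shuffle x (b ∷ t))) s∈
  ... | inj₁ s∈ˡ with ∈-map⁻ (a ∷_) s∈ˡ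
  ...   | _ , s′∈ , refl = consˡ (∈-shuffle⁻ x (b ∷ t) s′∈)
  ∈-shuffle⁻ (a ∷ x) (b ∷ t) s∈ | inj₂ s∈ʳ with ∈-map⁻ (b ∷_) s∈ʳ
  ...   | _ , s′∈ , refl = consʳ (∈-shuffle⁻ (a ∷ x) t s′∈)

  All-interleaving : ∀ {Q : A → Set} {x t s} → All Q x → All Q t → Interleaving x t s → All Q s
  All-interleaving [] [] [] = []
  All-interleaving (qa ∷ qx) qt (consˡ sp) = qa ∷ All-interleaving qx qt sp
  All-interleaving qx (qb ∷ qt) (consʳ sp) = qb ∷ All-interleaving qx qt sp

  interleaving-projections : ∀ {Q : A → Set} (Q? : Decidable Q) {x t s} →
    All Q x → All (∁ Q) t → Interleaving x t s →
    filter Q? s ≡ x × filter (¬? ∘ Q?) s ≡ t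
  interleaving-projections Q? [] [] [] = refl , refl
  interleaving-projections Q? (qa ∷ qx) ¬qt (consˡ sp) =
    let (x≡ , t≡) = interleaving-projections Q? qx ¬qt sp in
    trans (filter-accept Q? qa) (cong (_ ∷_) x≡) ,
    trans (filter-reject (¬? ∘ Q?) (λ ¬qa → ¬qa qa)) t≡
  interleaving-projections Q? qx (¬qb ∷ ¬qt) (consʳ sp) =
    let (x≡ , t≡) = interleaving-projections Q? qx ¬qt sp in
    trans (filter-reject Q? ¬qb) x≡ ,
    trans (filter-accept (¬? ∘ Q?) ¬qb) (cong (_ ∷_) t≡)

  -- On complementary alphabets the enumeration shuffle x t has no repetitions:
  -- the two halves of each step start with different letters.
  shuffle-unique : ∀ {Q : A → Set} {x t} → All Q x → All (∁ Q) t → Unique (shuffle x t)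
  shuffle-unique {x = []} {[]} _ _ = [] ∷ []
  shuffle-unique {x = []} {b ∷ t} [] (_ ∷ ¬qt) =
    Unique.map⁺ (proj₂ ∘ ∷-injective) (shuffle-unique [] ¬qt)
  shuffle-unique {x = a ∷ x} {[]} (_ ∷ qx) [] =
    Unique.map⁺ (proj₂ ∘ ∷-injective) (shuffle-unique qx [])
  shuffle-unique {x = a ∷ x} {b ∷ t} (qa ∷ qx) (¬qb ∷ ¬qt) =
    Unique.++⁺ (Unique.map⁺ (proj₂ ∘ ∷-injective) (shuffle-unique qx (¬qb ∷ ¬qt)))
               (Unique.map⁺ (proj₂ ∘ ∷-injective) (shuffle-unique (qa ∷ qx) ¬qt))
               headsDiffer
    where
    headsDiffer : ∀ {s} → ¬ (s ∈ map (a ∷_) (shuffle x (b ∷ t)) × s ∈ map (b ∷_) (shuffle (a ∷ x) t))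
    headsDiffer (s∈ˡ , s∈ʳ) with ∈-map⁻ (a ∷_) s∈ˡ | ∈-map⁻ (b ∷_) s∈ʳ
    ... | _ , _ , refl | _ , _ , refl = ¬qb qa

-- The number of interleavings of words of lengths m and n, by Pascal's rule;
-- it is the binomial coefficient (m + n choose m).
interleavings : ℕ → ℕ → ℕ
interleavings zero n = 1
interleavings (suc m) zero = 1
interleavings (suc m) (suc n) = interleavings m (suc n) + interleavings (suc m) n

interleavings-zeroʳ : ∀ m → interleavings m zero ≡ 1
interleavings-zeroʳ zero = refl
interleavings-zeroʳ (suc m) = refl

length-shuffle : ∀ {A : Set} (x t : List A) → length (shuffle x t) ≡ interleavings (length x) (length t)
length-shuffle [] [] = refl
length-shuffle [] (b ∷ t) = trans (length-map (b ∷_) (shuffle [] t)) (length-shuffle [] t)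
length-shuffle (a ∷ x) [] =
  trans (length-map (a ∷_) (shuffle x [])) (trans (length-shuffle x []) (interleavings-zeroʳ (length x)))
length-shuffle (a ∷ x) (b ∷ t) = begin
  length (map (a ∷_) (shuffle x (b ∷ t)) ++ map (b ∷_) (shuffle (a ∷ x) t))
    ≡⟨ length-++ (map (a ∷_) (shuffle x (b ∷ t))) ⟩
  length (map (a ∷_) (shuffle x (b ∷ t))) + length (map (b ∷_) (shuffle (a ∷ x) t))
    ≡⟨ cong₂ _+_ (length-map (a ∷_) (shuffle x (b ∷ t))) (length-map (b ∷_) (shuffle (a ∷ x) t)) ⟩
  length (shuffle x (b ∷ t)) + length (shuffle (a ∷ x) t)
    ≡⟨ cong₂ _+_ (length-shuffle x (b ∷ t)) (length-shuffle (a ∷ x) t) ⟩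
  interleavings (length x) (suc (length t)) + interleavings (suc (length x)) (length t) ∎
  where open ≡-Reasoning

interleavings-factorial : ∀ m n → interleavings m n * factorial m * factorial n ≡ factorial (m + n)
interleavings-factorial zero n = +-identityʳ (factorial n)
interleavings-factorial (suc m) zero =
  trans (*-identityʳ _) (trans (*-identityˡ _) (cong factorial (sym (+-identityʳ (suc m)))))
interleavings-factorial (suc m) (suc n) = begin
  (I₁ + I₂) * (suc m * factorial m) * (suc n * factorial n)
    ≡⟨ pascal-step I₁ I₂ m (factorial m) n (factorial n) ⟩
  suc m * (I₁ * factorial m * factorial (suc n)) + suc n * (I₂ * factorial (suc m) * factorial n)
    ≡⟨ cong₂ (λ u v → suc m * u + suc n * v) (interleavings-factorial m (suc n))
         (trans (interleavings-factorial (suc m) n) (cong factorial (sym (+-suc m n)))) ⟩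
  suc m * factorial (m + suc n) + suc n * factorial (m + suc n)
    ≡⟨ sym (*-distribʳ-+ (factorial (m + suc n)) (suc m) (suc n)) ⟩
  factorial (suc m + suc n) ∎
  where
  open ≡-Reasoning
  I₁ I₂ : ℕ
  I₁ = interleavings m (suc n)
  I₂ = interleavings (suc m) n
  pascal-step : ∀ i j m fm n fn → (i + j) * (suc m * fm) * (suc n * fn) ≡
    suc m * (i * fm * (suc n * fn)) + suc n * (j * (suc m * fm) * fn)
  pascal-step = solve-∀

module _ {A : Set} where

  shuffles : List (List A) → List (List A) → List (List A)
  shuffles X Y = concatMap (λ x → concatMap (shuffle x) Y) X

  ∈-shuffles⁺ : ∀ {X Y x t s} → x ∈ X → t ∈ Y → Interleaving x t s → s ∈ shuffles X Y
  ∈-shuffles⁺ x∈X t∈Y sp = ∈-concatMap⁺ _ (lose x∈X (∈-concatMap⁺ _ (lose t∈Y (∈-shuffle⁺ sp))))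

  ∈-shuffles⁻ : ∀ X Y {s} → s ∈ shuffles X Y →
    Σ (List A) λ x → Σ (List A) λ t → x ∈ X × t ∈ Y × Interleaving x t s
  ∈-shuffles⁻ X Y s∈ =
    let (x , x∈X , s∈ˣ) = find (∈-concatMap⁻ _ s∈)
        (t , t∈Y , s∈ˣᵗ) = find (∈-concatMap⁻ _ s∈ˣ)
    in x , t , x∈X , t∈Y , ∈-shuffle⁻ x t s∈ˣᵗ

  All-shuffles : ∀ {Q : A → Set} {X Y s} → (∀ {x} → x ∈ X → All Q x) → (∀ {t} → t ∈ Y → All Q t) →
    s ∈ shuffles X Y → All Q s
  All-shuffles {X = X} {Y} qX qY s∈ =
    let (x , t , x∈X , t∈Y , sp) = ∈-shuffles⁻ X Y s∈ in All-interleaving (qX x∈X) (qY t∈Y) sp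

  length-∈-shuffles : ∀ {X Y s p q} → (∀ {x} → x ∈ X → length x ≡ p) → (∀ {t} → t ∈ Y → length t ≡ q) →
    s ∈ shuffles X Y → length s ≡ p + q
  length-∈-shuffles {X} {Y} lenX lenY s∈ =
    let (x , t , x∈X , t∈Y , sp) = ∈-shuffles⁻ X Y s∈
    in trans (interleave-length sp) (cong₂ _+_ (lenX x∈X) (lenY t∈Y))

  length-shuffles : ∀ (X Y : List (List A)) {p q} → (∀ {x} → x ∈ X → length x ≡ p) →
    (∀ {t} → t ∈ Y → length t ≡ q) → length (shuffles X Y) ≡ length X * (length Y * interleavings p q)
  length-shuffles X Y lenX lenY =
    length-concatMap _ X λ {x} x∈X → length-concatMap (shuffle x) Y λ {t} t∈Y →
      trans (length-shuffle x t) (cong₂ interleavings (lenX x∈X) (lenY t∈Y))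

  -- If X is written in the letters satisfying Q and Y in the others, the shuffle
  -- product of two duplicate-free languages is duplicate-free: the projections
  -- of a shuffle recover the word of X and the word of Y it came from.
  shuffles-unique : ∀ {Q : A → Set} (Q? : Decidable Q) {X Y} → Unique X → Unique Y →
    (∀ {x} → x ∈ X → All Q x) → (∀ {t} → t ∈ Y → All (∁ Q) t) → Unique (shuffles X Y)
  shuffles-unique Q? {X} {Y} uX uY qX ¬qY =
    Unique-concatMap _ (filter Q?) uX uBlock projectionˡ
    where
    uBlock : ∀ {x} → x ∈ X → Unique (concatMap (shuffle x) Y)
    uBlock {x} x∈X = Unique-concatMap (shuffle x) (filter (¬? ∘ Q?)) uY
      (λ t∈Y → shuffle-unique (qX x∈X) (¬qY t∈Y))
      (λ {t} t∈Y s∈ → proj₂ (interleaving-projections Q? (qX x∈X) (¬qY t∈Y) (∈-shuffle⁻ x t s∈)))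
    projectionˡ : ∀ {x s} → x ∈ X → s ∈ concatMap (shuffle x) Y → filter Q? s ≡ x
    projectionˡ {x} x∈X s∈ =
      let (t , t∈Y , s∈ˣᵗ) = find (∈-concatMap⁻ _ s∈)
      in proj₁ (interleaving-projections Q? (qX x∈X) (¬qY t∈Y) (∈-shuffle⁻ x t s∈ˣᵗ))

data _∈ᵗ_ (m : ℕ) : BSTM → Set where
  left  : ∀ {L a k R} → m ∈ᵗ L → m ∈ᵗ node L a k R
  root  : ∀ {L k R} → m ∈ᵗ node L m k R
  right : ∀ {L a k R} → m ∈ᵗ R → m ∈ᵗ node L a k R

insert-< : ∀ {l a} L k R → l < a → insert l (node L a k R) ≡ node (insert l L) a k R
insert-< {l} {a} L k R l<a rewrite dec-false (l ≟ a) (<⇒≢ l<a) | dec-true (l <? a) l<a = refl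

insert-≡ : ∀ a L k R → insert a (node L a k R) ≡ node L a (suc k) R
insert-≡ a L k R rewrite dec-true (a ≟ a) refl = refl

insert-> : ∀ {l a} L k R → a < l → insert l (node L a k R) ≡ node L a k (insert l R)
insert-> {l} {a} L k R a<l rewrite dec-false (l ≟ a) (>⇒≢ a<l) | dec-false (l <? a) (<⇒≯ a<l) = refl

∈ᵗ-insert : ∀ l t → l ∈ᵗ insert l t
∈ᵗ-insert l leaf = root
∈ᵗ-insert l (node L a k R) with <-cmp l a
... | tri< l<a _ _ rewrite insert-< L k R l<a = left (∈ᵗ-insert l L)
... | tri≈ _ refl _ rewrite insert-≡ l L k R = root
... | tri> _ _ a<l rewrite insert-> L k R a<l = right (∈ᵗ-insert l R)

∈ᵗ-insert-mono : ∀ l t {m} → m ∈ᵗ t → m ∈ᵗ insert l t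
∈ᵗ-insert-mono l (node L a k R) m∈ with <-cmp l a | m∈
... | tri< l<a _ _ | left m∈L rewrite insert-< L k R l<a = left (∈ᵗ-insert-mono l L m∈L)
... | tri< l<a _ _ | root rewrite insert-< L k R l<a = root
... | tri< l<a _ _ | right m∈R rewrite insert-< L k R l<a = right m∈R
... | tri≈ _ refl _ | left m∈L rewrite insert-≡ l L k R = left m∈L
... | tri≈ _ refl _ | root rewrite insert-≡ l L k R = root
... | tri≈ _ refl _ | right m∈R rewrite insert-≡ l L k R = right m∈R
... | tri> _ _ a<l | left m∈L rewrite insert-> L k R a<l = left m∈L
... | tri> _ _ a<l | root rewrite insert-> L k R a<l = root
... | tri> _ _ a<l | right m∈R rewrite insert-> L k R a<l = right (∈ᵗ-insert-mono l R m∈R)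

∈ᵗ-insert⁻ : ∀ l t {m} → m ∈ᵗ insert l t → m ≡ l ⊎ m ∈ᵗ t
∈ᵗ-insert⁻ l leaf root = inj₁ refl
∈ᵗ-insert⁻ l (node L a k R) m∈ with <-cmp l a
... | tri< l<a _ _ rewrite insert-< L k R l<a with m∈
...   | left m∈L = Sum.map₂ left (∈ᵗ-insert⁻ l L m∈L)
...   | root = inj₂ root
...   | right m∈R = inj₂ (right m∈R)
∈ᵗ-insert⁻ l (node L a k R) m∈ | tri≈ _ refl _ rewrite insert-≡ l L k R with m∈
...   | left m∈L = inj₂ (left m∈L)
...   | root = inj₂ root
...   | right m∈R = inj₂ (right m∈R)
∈ᵗ-insert⁻ l (node L a k R) m∈ | tri> _ _ a<l rewrite insert-> L k R a<l with m∈
...   | left m∈L = inj₂ (left m∈L)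
...   | root = inj₂ root
...   | right m∈R = Sum.map₂ right (∈ᵗ-insert⁻ l R m∈R)

∈ᵗ-P⁺ : ∀ u {m} → m ∈ u → m ∈ᵗ P u
∈ᵗ-P⁺ (l ∷ u) (here refl) = ∈ᵗ-insert l (P u)
∈ᵗ-P⁺ (l ∷ u) (there m∈u) = ∈ᵗ-insert-mono l (P u) (∈ᵗ-P⁺ u m∈u)

∈ᵗ-P⁻ : ∀ u {m} → m ∈ᵗ P u → m ∈ u
∈ᵗ-P⁻ (l ∷ u) m∈ with ∈ᵗ-insert⁻ l (P u) m∈
... | inj₁ refl = here refl
... | inj₂ m∈P = there (∈ᵗ-P⁻ u m∈P)

Between : ℕ → ℕ → ℕ → Set
Between lo hi l = lo ≤ l × l < hi

data Search : ℕ → ℕ → BSTM → Set where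
  leaf : ∀ {lo hi} → Search lo hi leaf
  node : ∀ {lo hi L a k R} → Between lo hi a → Search lo a L → Search (suc a) hi R →
         Search lo hi (node L a k R)

search-bounds : ∀ {lo hi t m} → Search lo hi t → m ∈ᵗ t → Between lo hi m
search-bounds (node (_ , a<hi) sL _) (left m∈L) =
  let (lo≤m , m<a) = search-bounds sL m∈L in lo≤m , <-trans m<a a<hi
search-bounds (node a∈ _ _) root = a∈
search-bounds (node (lo≤a , _) _ sR) (right m∈R) =
  let (a<m , m<hi) = search-bounds sR m∈R in ≤-trans lo≤a (<⇒≤ a<m) , m<hi

search-insert : ∀ {lo hi l} t → Between lo hi l → Search lo hi t → Search lo hi (insert l t)
search-insert leaf l∈ leaf = node l∈ leaf leaf
search-insert {l = l} (node L a k R) (lo≤l , l<hi) (node a∈ sL sR) with <-cmp l a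
... | tri< l<a _ _ rewrite insert-< L k R l<a = node a∈ (search-insert L (lo≤l , l<a) sL) sR
... | tri≈ _ refl _ rewrite insert-≡ l L k R = node a∈ sL sR
... | tri> _ _ a<l rewrite insert-> L k R a<l = node a∈ sL (search-insert R (a<l , l<hi) sR)

search-P : ∀ {lo hi} u → All (Between lo hi) u → Search lo hi (P u)
search-P [] [] = leaf
search-P (l ∷ u) (l∈ ∷ u∈) = search-insert (P u) l∈ (search-P u u∈)

nodes : BTM → ℕ
nodes leaf = 0
nodes (node L k R) = nodes L + suc (nodes R)

-- The canonical labelling of the shape T by the letters o, o+1, …, o + nodes T - 1 in
-- symmetric (in-)order: the unique search tree of shape T on the interval [o, o + nodes T).
labelFrom : ℕ → BTM → BSTM
labelFrom o leaf = leaf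
labelFrom o (node L k R) = node (labelFrom o L) (o + nodes L) k (labelFrom (suc (o + nodes L)) R)

forget-labelFrom : ∀ o T → forget (labelFrom o T) ≡ T
forget-labelFrom o leaf = refl
forget-labelFrom o (node L k R) = cong₂ (λ L′ R′ → node L′ k R′) (forget-labelFrom o L) (forget-labelFrom _ R)

-- Splitting the interval [o, o + nodes (node L k R)) at the root letter o + nodes L.
nodes-split : ∀ o p q → o + (p + suc q) ≡ suc (o + p) + q
nodes-split = solve-∀

search-labelFrom : ∀ o T → Search o (o + nodes T) (labelFrom o T)
search-labelFrom o leaf = leaf
search-labelFrom o (node L k R) =
  node (m≤m+n o (nodes L) ,
        subst (o + nodes L <_) (sym (nodes-split o (nodes L) (nodes R))) (s≤s (m≤m+n _ _)))
       (search-labelFrom o L)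
       (subst (λ hi → Search (suc (o + nodes L)) hi (labelFrom (suc (o + nodes L)) R))
              (sym (nodes-split o (nodes L) (nodes R)))
              (search-labelFrom (suc (o + nodes L)) R))

labelFrom-covers : ∀ o T {l} → Between o (o + nodes T) l → l ∈ᵗ labelFrom o T
labelFrom-covers o leaf (o≤l , l<o+0) = ⊥-elim (<⇒≱ (subst (_ <_) (+-identityʳ o) l<o+0) o≤l)
labelFrom-covers o (node L k R) {l} (o≤l , l<hi) with <-cmp l (o + nodes L)
... | tri< l<a _ _ = left (labelFrom-covers o L (o≤l , l<a))
... | tri≈ _ refl _ = root
... | tri> _ _ a<l = right (labelFrom-covers _ R (a<l , subst (l <_) (nodes-split o (nodes L) (nodes R)) l<hi))

search-canonical : ∀ {lo hi} t → Search lo hi t → lo ≤ hi → (∀ {l} → Between lo hi l → l ∈ᵗ t) →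
  t ≡ labelFrom lo (forget t) × lo + nodes (forget t) ≡ hi
search-canonical leaf leaf lo≤hi covers with m≤n⇒m<n∨m≡n lo≤hi
... | inj₁ lo<hi with covers (≤-refl , lo<hi)
...   | ()
search-canonical leaf leaf lo≤hi covers | inj₂ lo≡hi = refl , trans (+-identityʳ _) lo≡hi
search-canonical {lo} (node L a k R) (node (lo≤a , a<hi) sL sR) _ covers
  with search-canonical L sL lo≤a coversL | search-canonical R sR a<hi coversR
  where
  coversL : ∀ {l} → Between lo a l → l ∈ᵗ L
  coversL (lo≤l , l<a) with covers (lo≤l , <-trans l<a a<hi)
  ... | left l∈L = l∈L
  ... | root = ⊥-elim (<-irrefl refl l<a)
  ... | right l∈R = ⊥-elim (<-asym l<a (proj₁ (search-bounds sR l∈R)))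
  coversR : ∀ {l} → Between (suc a) _ l → l ∈ᵗ R
  coversR (a<l , l<hi) with covers (≤-trans lo≤a (<⇒≤ a<l) , l<hi)
  ... | left l∈L = ⊥-elim (<-asym a<l (proj₂ (search-bounds sL l∈L)))
  ... | root = ⊥-elim (<-irrefl refl a<l)
  ... | right l∈R = l∈R
... | L≡ , refl | R≡ , hi≡ =
  cong₂ (λ L′ R′ → node L′ (lo + nodes (forget L)) k R′) L≡ R≡ , trans (nodes-split lo _ _) hi≡

size-insert : ∀ l t → size (forget (insert l t)) ≡ suc (size (forget t))
size-insert l leaf = refl
size-insert l (node L a k R) with <-cmp l a
... | tri< l<a _ _ rewrite insert-< L k R l<a | size-insert l L = refl
... | tri≈ _ refl _ rewrite insert-≡ l L k R = cong (_+ size (forget R)) (+-suc (size (forget L)) k)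
... | tri> _ _ a<l rewrite insert-> L k R a<l | size-insert l R = +-suc _ _

size-B : ∀ u → size (B u) ≡ length u
size-B [] = refl
size-B (l ∷ u) = trans (size-insert l (P u)) (cong suc (size-B u))

-- This holds for every B(w) and is the only use of
-- the hypothesis that T is of that form: a node of multiplicity 0 is realised by no
-- word, although it does not make hookProd vanish.
data Positive : BTM → Set where
  leaf : Positive leaf
  node : ∀ {L k R} → Positive L → Positive R → Positive (node L (suc k) R)

positive-insert : ∀ l t → Positive (forget t) → Positive (forget (insert l t))
positive-insert l leaf leaf = node leaf leaf
positive-insert l (node L a (suc k) R) (node pL pR) with <-cmp l a
... | tri< l<a _ _ rewrite insert-< L (suc k) R l<a = node (positive-insert l L pL) pR
... | tri≈ _ refl _ rewrite insert-≡ l L (suc k) R = node pL pR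
... | tri> _ _ a<l rewrite insert-> L (suc k) R a<l = node pL (positive-insert l R pR)

positive-B : ∀ w → Positive (B w)
positive-B [] = leaf
positive-B (l ∷ w) = positive-insert l (P w) (positive-B w)

Word : Set
Word = List ℕ

module AroundLetter (a : ℕ) where

  below : Word → Word
  below = filter (_<? a)

  notBelow : Word → Word
  notBelow = filter (¬? ∘ (_<? a))

  above : Word → Word
  above = filter (a <?_)

  copies : Word → Word
  copies = filter (¬? ∘ (a <?_))

  -- Reading a word from right to left, its last letter a becomes the root; every
  -- later insertion goes left, increments the root, or goes right, according to
  -- how the letter compares with a.
  P-snoc : ∀ v →
    P (v ∷ʳ a) ≡ node (P (below v)) a (suc (length (copies (notBelow v)))) (P (above (notBelow v)))
  P-snoc [] = refl
  P-snoc (l ∷ v) with <-cmp l a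
  ... | tri< l<a _ _
    rewrite P-snoc v | filter-accept (_<? a) {xs = v} l<a
          | filter-reject (¬? ∘ (_<? a)) {xs = v} (λ l≮a → l≮a l<a) = insert-< _ _ _ l<a
  ... | tri≈ _ refl _
    rewrite P-snoc v | filter-reject (_<? a) {xs = v} (n≮n a)
          | filter-accept (¬? ∘ (_<? a)) {xs = v} (n≮n a)
          | filter-reject (a <?_) {xs = notBelow v} (n≮n a)
          | filter-accept (¬? ∘ (a <?_)) {xs = notBelow v} (n≮n a) = insert-≡ a _ _ _
  ... | tri> _ _ a<l
    rewrite P-snoc v | filter-reject (_<? a) {xs = v} (<⇒≯ a<l)
          | filter-accept (¬? ∘ (_<? a)) {xs = v} (<⇒≯ a<l)
          | filter-accept (a <?_) {xs = notBelow v} a<l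
          | filter-reject (¬? ∘ (a <?_)) {xs = notBelow v} (λ a≮l → a≮l a<l) = insert-> _ _ _ a<l

  all-equal-replicate : ∀ {w} → All (_≡ a) w → w ≡ replicate (length w) a
  all-equal-replicate [] = refl
  all-equal-replicate (refl ∷ w≡) = cong (a ∷_) (all-equal-replicate w≡)

  powerOf : ℕ → List Word
  powerOf k = [ replicate k a ]

  ∈-powerOf : ∀ {k z} → z ∈ powerOf k → All (_≡ a) z × length z ≡ k
  ∈-powerOf {k} (here refl) = replicate⁺ k refl , length-replicate k

  glue : List Word → List Word → ℕ → List Word
  glue X Y k = map (_∷ʳ a) (shuffles X (shuffles Y (powerOf k)))

  module _ {X Y : List Word} {k : ℕ}
           (X<a : ∀ {x} → x ∈ X → All (_< a) x) (a<Y : ∀ {y} → y ∈ Y → All (a <_) y) where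

    private
      copies≮ : ∀ {z} → z ∈ powerOf k → All (∁ (a <_)) z
      copies≮ z∈ = All.map (λ { refl → n≮n a }) (proj₁ (∈-powerOf z∈))

      rest≮ : ∀ {t} → t ∈ shuffles Y (powerOf k) → All (∁ (_< a)) t
      rest≮ = All-shuffles {X = Y} {powerOf k} (λ y∈Y → All.map <⇒≯ (a<Y y∈Y))
                (λ z∈ → All.map (λ { refl → n≮n a }) (proj₁ (∈-powerOf z∈)))

    glue-sound : ∀ {u} → u ∈ glue X Y k →
      Σ Word λ x → Σ Word λ y → x ∈ X × y ∈ Y × P u ≡ node (P x) a (suc k) (P y)
    glue-sound u∈ with ∈-map⁻ (_∷ʳ a) u∈
    ... | s , s∈ , refl with ∈-shuffles⁻ X _ s∈
    ... | x , t , x∈X , t∈ , s∈x⧢t with ∈-shuffles⁻ Y (powerOf k) t∈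
    ... | y , _ , y∈Y , here refl , t∈y⧢z =
      x , y , x∈X , y∈Y , (begin
        P (s ∷ʳ a)
          ≡⟨ P-snoc s ⟩
        node (P (below s)) a (suc (length (copies (notBelow s)))) (P (above (notBelow s)))
          ≡⟨ cong₂ (λ x′ t′ → node (P x′) a (suc (length (copies t′))) (P (above t′)))
                   (proj₁ splitAtA) (proj₂ splitAtA) ⟩
        node (P x) a (suc (length (copies t))) (P (above t))
          ≡⟨ cong₂ (λ y′ z′ → node (P x) a (suc (length z′)) (P y′))
                   (proj₁ splitRest) (proj₂ splitRest) ⟩
        node (P x) a (suc (length (replicate k a))) (P y)
          ≡⟨ cong (λ n → node (P x) a (suc n) (P y)) (length-replicate k) ⟩
        node (P x) a (suc k) (P y) ∎)
      where
      open ≡-Reasoning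
      splitAtA : below s ≡ x × notBelow s ≡ t
      splitAtA = interleaving-projections (_<? a) (X<a x∈X) (rest≮ t∈) s∈x⧢t
      splitRest : above t ≡ y × copies t ≡ replicate k a
      splitRest = interleaving-projections (a <?_) (a<Y y∈Y) (copies≮ (here refl)) t∈y⧢z

    -- No repetitions: the projections onto the three alphabets recover the pieces
    -- (shuffles-unique, used twice), and appending a is injective.
    glue-unique : Unique X → Unique Y → Unique (glue X Y k)
    glue-unique uX uY =
      Unique.map⁺ (λ {s} {s′} → ∷ʳ-injectiveˡ s s′)
        (shuffles-unique (_<? a) {X} uX (shuffles-unique (a <?_) {Y} uY ([] ∷ []) a<Y copies≮) X<a rest≮)

  glue-complete : ∀ {X Y k} v → below v ∈ X → above (notBelow v) ∈ Y →
    length (copies (notBelow v)) ≡ k → v ∷ʳ a ∈ glue X Y k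
  glue-complete {k = k} v x∈X y∈Y #copies =
    ∈-map⁺ (_∷ʳ a)
      (∈-shuffles⁺ x∈X (∈-shuffles⁺ {Y = powerOf k} y∈Y (here z≡) (filter⁺ (a <?_) (notBelow v)))
                   (filter⁺ (_<? a) v))
    where
    -- A letter that is neither below nor above a equals a.
    z≡ : copies (notBelow v) ≡ replicate k a
    z≡ = trans (all-equal-replicate (All.zipWith (λ (a≮l , l≮a) → ≤-antisym (≮⇒≥ a≮l) (≮⇒≥ l≮a))
                                      (all-filter (¬? ∘ (a <?_)) (notBelow v) ,
                                       All.filter⁺ (¬? ∘ (a <?_)) (all-filter (¬? ∘ (_<? a)) v))))
               (cong (λ n → replicate n a) #copies)

  length-glue : ∀ (X Y : List Word) k {p q} →
    (∀ {x} → x ∈ X → length x ≡ p) → (∀ {y} → y ∈ Y → length y ≡ q) →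
    length (glue X Y k) ≡ length X * (length Y * (1 * interleavings q k) * interleavings p (q + k))
  length-glue X Y k {p} {q} lenX lenY = begin
    length (glue X Y k)
      ≡⟨ length-map (_∷ʳ a) (shuffles X (shuffles Y (powerOf k))) ⟩
    length (shuffles X (shuffles Y (powerOf k)))
      ≡⟨ length-shuffles X (shuffles Y (powerOf k)) lenX
           (length-∈-shuffles {X = Y} {powerOf k} lenY (proj₂ ∘ ∈-powerOf)) ⟩
    length X * (length (shuffles Y (powerOf k)) * interleavings p (q + k))
      ≡⟨ cong (λ n → length X * (n * interleavings p (q + k)))
              (length-shuffles Y (powerOf k) lenY (proj₂ ∘ ∈-powerOf)) ⟩
    length X * (length Y * (1 * interleavings q k) * interleavings p (q + k)) ∎
    where open ≡-Reasoning

canonical-letters : ∀ o T {u} → P u ≡ labelFrom o T → All (Between o (o + nodes T)) u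
canonical-letters o T {u} Pu≡ =
  All.tabulate λ {l} l∈u → search-bounds (search-labelFrom o T) (subst (l ∈ᵗ_) Pu≡ (∈ᵗ-P⁺ u l∈u))

node-injective : ∀ {L a k R L′ a′ k′ R′} → node L a k R ≡ node L′ a′ k′ R′ →
  L ≡ L′ × a ≡ a′ × k ≡ k′ × R ≡ R′
node-injective refl = refl , refl , refl , refl

-- preimage o T lists the words u with P(u) = labelFrom o T: the last letter is the
-- root o + nodes L, and the rest interleaves a word for the left subtree, a word for
-- the right subtree and the remaining copies of the root letter.
preimage : ℕ → BTM → List Word
preimage o leaf = [ [] ]
preimage o (node L zero R) = []
preimage o (node L (suc k) R) = AroundLetter.glue (o + nodes L) (preimage o L) (preimage (suc (o + nodes L)) R) k

left-letters : ∀ o L {x} → P x ≡ labelFrom o L → All (_< o + nodes L) x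
left-letters o L Px≡ = All.map proj₂ (canonical-letters o L Px≡)

right-letters : ∀ a R {y} → P y ≡ labelFrom (suc a) R → All (a <_) y
right-letters a R Py≡ = All.map proj₁ (canonical-letters (suc a) R Py≡)

-- Soundness, completeness and uniqueness of the enumeration, by induction on T;
-- the letter bounds that glue needs come from soundness for the subtrees.
preimage-sound : ∀ o T {u} → u ∈ preimage o T → P u ≡ labelFrom o T
preimage-sound o leaf (here refl) = refl
preimage-sound o (node L (suc k) R) u∈
  with AroundLetter.glue-sound (o + nodes L) (λ x∈ → left-letters o L (preimage-sound o L x∈))
         (λ y∈ → right-letters (o + nodes L) R (preimage-sound _ R y∈)) u∈
... | x , y , x∈ , y∈ , Pu≡ =
  trans Pu≡ (cong₂ (λ L′ R′ → node L′ (o + nodes L) (suc k) R′)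
                   (preimage-sound o L x∈) (preimage-sound _ R y∈))

-- A word realising a node is nonempty; P-snoc at its last letter identifies the
-- three pieces, which realise the subtrees.
preimage-complete : ∀ o T u → P u ≡ labelFrom o T → u ∈ preimage o T
preimage-complete o T u Pu≡ with initLast u
preimage-complete o leaf _ _ | [] = here refl
preimage-complete o (node L k R) _ () | []
preimage-complete o T _ Pu≡ | v ∷ʳ′ b
  with trans (sym (AroundLetter.P-snoc b v)) Pu≡
preimage-complete o leaf _ _ | v ∷ʳ′ b | ()
preimage-complete o (node L (suc k) R) _ _ | v ∷ʳ′ b | root≡
  with node-injective root≡
... | Px≡ , refl , #copies , Py≡ =
  AroundLetter.glue-complete b v (preimage-complete o L _ Px≡) (preimage-complete _ R _ Py≡)
    (suc-injective #copies)

preimage-unique : ∀ o T → Unique (preimage o T)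
preimage-unique o leaf = [] ∷ []
preimage-unique o (node L zero R) = []
preimage-unique o (node L (suc k) R) =
  AroundLetter.glue-unique (o + nodes L)
    (λ x∈ → left-letters o L (preimage-sound o L x∈))
    (λ y∈ → right-letters (o + nodes L) R (preimage-sound _ R y∈))
    (preimage-unique o L) (preimage-unique _ R)

-- Every word of preimage o T has length |T|, since |B(u)| = |u| and B(u) = T.
length-∈-preimage : ∀ o T {u} → u ∈ preimage o T → length u ≡ size T
length-∈-preimage o T {u} u∈ =
  trans (sym (size-B u)) (cong size (trans (cong forget (preimage-sound o T u∈)) (forget-labelFrom o T)))

preimage-count : ∀ o T → Positive T → length (preimage o T) * hookProd T ≡ factorial (size T)
preimage-count o leaf leaf = refl
preimage-count o (node L (suc k) R) (node pL pR) = begin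
  length (preimage o (node L (suc k) R)) * hookProd (node L (suc k) R)
    ≡⟨ cong (_* hookProd (node L (suc k) R))
         (AroundLetter.length-glue a (preimage o L) (preimage (suc a) R) k
           (length-∈-preimage o L) (length-∈-preimage (suc a) R)) ⟩
  cL * (cR * (1 * Iᵣ) * Iₗ) * (N * factorial k * hookProd L * hookProd R)
    ≡⟨ regroup cL cR Iᵣ Iₗ N (factorial k) (hookProd L) (hookProd R) ⟩
  N * (Iₗ * (cL * hookProd L) * (Iᵣ * (cR * hookProd R) * factorial k))
    ≡⟨ cong₂ (λ fp fq → N * (Iₗ * fp * (Iᵣ * fq * factorial k)))
         (preimage-count o L pL) (preimage-count (suc a) R pR) ⟩
  N * (Iₗ * factorial p * (Iᵣ * factorial q * factorial k))
    ≡⟨ cong (λ f → N * (Iₗ * factorial p * f)) (interleavings-factorial q k) ⟩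
  N * (Iₗ * factorial p * factorial (q + k))
    ≡⟨ cong (N *_) (interleavings-factorial p (q + k)) ⟩
  N * factorial (p + (q + k))
    ≡⟨ cong (λ n → n * factorial (p + (q + k))) (size-regroup p k q) ⟩
  factorial (suc (p + (q + k)))
    ≡⟨ cong factorial (sym (size-regroup p k q)) ⟩
  factorial N ∎
  where
  open ≡-Reasoning
  a p q N cL cR Iₗ Iᵣ : ℕ
  a = o + nodes L
  p = size L
  q = size R
  N = p + suc k + q
  cL = length (preimage o L)
  cR = length (preimage (suc a) R)
  Iₗ = interleavings p (q + k)
  Iᵣ = interleavings q k
  regroup : ∀ cL cR Iᵣ Iₗ N fk hL hR →
    cL * (cR * (1 * Iᵣ) * Iₗ) * (N * fk * hL * hR) ≡ N * (Iₗ * (cL * hL) * (Iᵣ * (cR * hR) * fk))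
  regroup = solve-∀
  size-regroup : ∀ p k q → p + suc k + q ≡ suc (p + (q + k))
  size-regroup = solve-∀

preimage-correct : ∀ o T u → u ∈ preimage o T ⇔ P u ≡ labelFrom o T
preimage-correct o T u = mk⇔ (preimage-sound o T) (preimage-complete o T u)

-- A word is packed with B(u) = T exactly when P(u) is the canonical labelling of T
-- from 1: a packed word with letters {1,…,r} gives a search tree on [1, r + 1) using
-- every letter, and conversely the canonical labelling uses exactly the letters 1,…,nodes T.
packed-iff-canonical : ∀ T u → (Packed u × B u ≡ T) ⇔ (P u ≡ labelFrom 1 T)
packed-iff-canonical T u = mk⇔ canonical packed
  where
  canonical : Packed u × B u ≡ T → P u ≡ labelFrom 1 T
  canonical ((r , inRange , covered) , Bu≡) =
    trans (proj₁ (search-canonical (P u) (search-P u u∈[1,r]) (s≤s z≤n) covers)) (cong (labelFrom 1) Bu≡)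
    where
    u∈[1,r] : All (Between 1 (suc r)) u
    u∈[1,r] = All.tabulate λ {l} l∈u → let (1≤l , l≤r) = inRange l l∈u in 1≤l , s≤s l≤r
    covers : ∀ {l} → Between 1 (suc r) l → l ∈ᵗ P u
    covers {l} (1≤l , l<1+r) = ∈ᵗ-P⁺ u (covered l 1≤l (s≤s⁻¹ l<1+r))
  packed : P u ≡ labelFrom 1 T → Packed u × B u ≡ T
  packed Pu≡ = (nodes T , inRange , covered) , trans (cong forget Pu≡) (forget-labelFrom 1 T)
    where
    inRange : ∀ l → l ∈ u → 1 ≤ l × l ≤ nodes T
    inRange l l∈u = let (1≤l , l<1+n) = All.lookup (canonical-letters 1 T Pu≡) l∈u in 1≤l , s≤s⁻¹ l<1+n
    covered : ∀ l → 1 ≤ l → l ≤ nodes T → l ∈ u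
    covered l 1≤l l≤n = ∈ᵗ-P⁻ u (subst (l ∈ᵗ_) (sym Pu≡) (labelFrom-covers 1 T (1≤l , s≤s l≤n)))

mainTheorem11 : (T : BTM) → (w : List ℕ) → Packed w → B w ≡ T →
    Σ (List (List ℕ)) λ us →
      Unique us × ((u : List ℕ) → (u ∈ us ⇔ (Packed u × B u ≡ T))) ×
      (length us * hookProd T ≡ factorial (size T))
mainTheorem11 T w _ Bw≡T =
  preimage 1 T ,
  preimage-unique 1 T ,
  (λ u → ⇔.trans (preimage-correct 1 T u) (⇔.sym (packed-iff-canonical T u))) ,
  preimage-count 1 T (subst Positive Bw≡T (positive-B w))
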